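{- Let $\pi_1,\pi_2\in\mathrm{NC}_B(n)$ with $\psi(\pi_1)=(\sigma_1,x_1)$ and $\psi(\pi_2)=(\sigma_2,x_2)$. Then $\pi_1\le\pi_2$ if and only if $\sigma_1\le\sigma_2$ and one of the following holds: (1) $x_1=x_2=\emptyset$; (2) $x_2$ is an edge $(a,b)$ of $\sigma_2$, and $x_1$ is the unique minimal length edge $(i,j)$ of $\sigma_1$ with $i\le a<b\le j$ if such an edge exists, and $x_1=\emptyset$ otherwise; (3) $x_2$ is a block of $\sigma_2$ and $x_1$ is a block of $\sigma_1$ with $x_1\subseteq x_2$; (4) $x_2$ is a block of $\sigma_2$ and $x_1$ is an edge $(i,j)$ of $\sigma_1$ with $i,j\in x_2$; (5) $x_2$ is a block of $\sigma_2$ and $x_1$ is the minimal length edge $(i,j)$ of $\sigma_1$ with $i<\min(x_2)\le\max(x_2)<j$ if such an edge exists, and $x_1=\emptyset$ otherwise.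
   Context: $\mathrm{NC}(n)$: noncrossing partitions of $[n]$ (no $a<b<c<d$ with $a,c\in B$, $b,d\in B'$, $B\ne B'$ blocks), ordered by refinement. An edge of $\sigma\in\mathrm{NC}(n)$ is a pair $(i,j)$, $i<j$, of elements of the same block with no element of that block strictly between them; its length is $j-i$. $\mathrm{NC}_B(n)$: set partitions $\pi$ of $\{\pm1,\dots,\pm n\}$ with $-B$ a block whenever $B$ is, at most one block with $B=-B$ (the zero block), and noncrossing when $1,\dots,n,-1,\dots,-n$ are placed in this order around a circle (convex hulls of blocks disjoint); ordered by refinement. $\mathfrak B(n)$ is the set of pairs $(\sigma,x)$ with $\sigma\in\mathrm{NC}(n)$ and $x$ either $\emptyset$, an edge of $\sigma$, or a block of $\sigma$. The map $\psi:\mathrm{NC}_B(n)\to\mathfrak B(n)$ is defined as follows: given $\pi$, let $\eta\in\mathrm{NC}(n)$ have as blocks the nonempty sets $C\cap[n]$, $C$ a block of $\pi$; let $A_1,\dots,A_m$ be the blocks $A$ of $\eta$ such that the block of $\pi$ containing $A$ contains a negative integer, ordered so that $\max A_1<\cdots<\max A_m$ (then $\max A_i<\min A_{i+1}$). Let $\sigma$ be obtained from $\eta$ by merging $A_i$ and $A_{m+1-i}$ for $1\le i\le\lfloor m/2\rfloor$, and let $x=\emptyset$ if $m=0$, $x=(\max A_{m/2},\min A_{m/2+1})$ (an edge of $\sigma$) if $m>0$ is even, and $x=A_{(m+1)/2}$ if $m$ is odd. Then $\psi(\pi)=(\sigma,x)$. -}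

module Defs where

open import Data.Bool using (Bool; true; false; T; _∧_; _∨_; not)
open import Data.Nat using (ℕ; zero; suc; _+_; _∸_; _≡ᵇ_; _<ᵇ_; _≤ᵇ_; _/_; _%_)
import Data.Nat as ℕ
open import Data.Fin using (Fin; toℕ)
open import Data.List using (List; allFin; filterᵇ; length)
open import Data.Bool.ListAction using (any)
open import Data.Product using (Σ; ∃; ∃-syntax; _×_; _,_)
open import Data.Sum using (_⊎_)
open import Relation.Nullary using (¬_)
open import Relation.Binary.PropositionalEquality using (_≡_)

-- Set partitions given by their (decidable) "same block" relation.

BRel : Set → Set
BRel A = A → A → Bool

record IsEquivalenceᵇ {A : Set} (r : BRel A) : Set where
  field
    reflᵇ  : ∀ a → T (r a a)
    symᵇ   : ∀ a b → T (r a b) → T (r b a)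
    transᵇ : ∀ a b c → T (r a b) → T (r b c) → T (r a c)

-- noncrossing w.r.t. a linear (or cyclic) position function:
-- no a<b<c<d with a,c in one block and b,d in a different block
NoncrossingWrt : {A : Set} → (A → ℕ) → BRel A → Set
NoncrossingWrt {A} p r = ∀ (a b c d : A) →
  p a ℕ.< p b → p b ℕ.< p c → p c ℕ.< p d →
  T (r a c) → T (r b d) → T (r a b)

-- NC(n): noncrossing partitions of [n] = Fin n (i ↦ i+1)
record NC (n : ℕ) : Set where
  field
    rel     : BRel (Fin n)
    isEquiv : IsEquivalenceᵇ rel
    noncr   : NoncrossingWrt toℕ rel
open NC public

_≤ʳ_ : {A : Set} → BRel A → BRel A → Set
r ≤ʳ s = ∀ a b → T (r a b) → T (s a b)

_≤NC_ : {n : ℕ} → NC n → NC n → Set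
σ ≤NC τ = rel σ ≤ʳ rel τ

-- NC_B(n): elements ±1..±n encoded as (sign , i) with i : Fin n
-- (pos , i) = i+1 ,  (neg , i) = -(i+1)

data Sgn : Set where
  pos neg : Sgn

SElt : ℕ → Set
SElt n = Sgn × Fin n

flipS : Sgn → Sgn
flipS pos = neg
flipS neg = pos

minus : {n : ℕ} → SElt n → SElt n
minus (s , i) = flipS s , i

-- position on the circle 1,...,n,-1,...,-n
circPos : {n : ℕ} → SElt n → ℕ
circPos (pos , i) = toℕ i
circPos {n} (neg , i) = n + toℕ i

record NCB (n : ℕ) : Set where
  field
    relB     : BRel (SElt n)
    isEquivB : IsEquivalenceᵇ relB
    noncrB   : NoncrossingWrt circPos relB
    -- -B is a block whenever B is
    symmB    : ∀ a b → relB (minus a) (minus b) ≡ relB a b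
    -- at most one block B with B = -B
    zeroB    : ∀ a b → T (relB a (minus a)) → T (relB b (minus b)) → T (relB a b)
open NCB public

_≤NCB_ : {n : ℕ} → NCB n → NCB n → Set
π ≤NCB ρ = relB π ≤ʳ relB ρ

_<ᶠ_ : {n : ℕ} → Fin n → Fin n → Bool
i <ᶠ j = toℕ i <ᵇ toℕ j

_≤ᶠ_ : {n : ℕ} → Fin n → Fin n → Bool
i ≤ᶠ j = toℕ i ≤ᵇ toℕ j

module ψ-construction {n : ℕ} (π : NCB n) where

  η : BRel (Fin n)
  η i j = relB π (pos , i) (pos , j)

  touch : Fin n → Bool
  touch i = any (λ k → relB π (pos , i) (neg , k)) (allFin n)

  isMax : Fin n → Bool
  isMax i = not (any (λ j → η i j ∧ (i <ᶠ j)) (allFin n))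

  isMin : Fin n → Bool
  isMin i = not (any (λ j → η i j ∧ (j <ᶠ i)) (allFin n))

  -- m = number of blocks A_1,...,A_m
  m : ℕ
  m = length (filterᵇ (λ j → touch j ∧ isMax j) (allFin n))

  -- for touching i: the index r with i ∈ A_r (blocks ordered by their maxima)
  rank : Fin n → ℕ
  rank i = length (filterᵇ (λ j → touch j ∧ isMax j ∧
                     any (λ k → η i k ∧ (j ≤ᶠ k)) (allFin n)) (allFin n))

  -- σ: merge A_r with A_{m+1-r}
  σ : BRel (Fin n)
  σ i j = η i j ∨ (touch i ∧ touch j ∧ (rank i + rank j ≡ᵇ suc m))

data Decor (n : ℕ) : Set where
  none  : Decor n
  edge  : Fin n → Fin n → Decor n
  block : (Fin n → Bool) → Decor n

ψσ : {n : ℕ} → NCB n → BRel (Fin n)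
ψσ π = ψ-construction.σ π

data ψx {n : ℕ} (π : NCB n) : Decor n → Set where
  x-empty : ψ-construction.m π ≡ 0 → ψx π none
  x-edge  : ∀ a b →
    ψ-construction.m π % 2 ≡ 0 → ¬ (ψ-construction.m π ≡ 0) →
    T (ψ-construction.touch π a) → T (ψ-construction.isMax π a) →
    ψ-construction.rank π a ≡ ψ-construction.m π / 2 →
    T (ψ-construction.touch π b) → T (ψ-construction.isMin π b) →
    ψ-construction.rank π b ≡ suc (ψ-construction.m π / 2) →
    ψx π (edge a b)
  x-block : ∀ (B : Fin n → Bool) →
    ψ-construction.m π % 2 ≡ 1 →
    (∀ i → B i ≡ (ψ-construction.touch π i ∧
                  (ψ-construction.rank π i ≡ᵇ suc (ψ-construction.m π) / 2))) →
    ψx π (block B)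

IsEdge : {n : ℕ} → BRel (Fin n) → Fin n → Fin n → Set
IsEdge r i j = toℕ i ℕ.< toℕ j × T (r i j) ×
  (∀ k → toℕ i ℕ.< toℕ k → toℕ k ℕ.< toℕ j → ¬ T (r i k))

edgeLength : {n : ℕ} → Fin n → Fin n → ℕ
edgeLength i j = toℕ j ∸ toℕ i

IsBlock : {n : ℕ} → BRel (Fin n) → (Fin n → Bool) → Set
IsBlock {n} r B = ∃[ i ] (∀ k → B k ≡ r i k)

_⊆ᵇ_ : {n : ℕ} → (Fin n → Bool) → (Fin n → Bool) → Set
B ⊆ᵇ C = ∀ k → T (B k) → T (C k)

MinEdgeOrEmpty : {n : ℕ} → BRel (Fin n) → (Fin n → Fin n → Set) → Decor n → Set
MinEdgeOrEmpty {n} σ₁ P x₁ =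
  (∃[ i ] ∃[ j ] (x₁ ≡ edge i j × IsEdge σ₁ i j × P i j ×
     (∀ i' j' → IsEdge σ₁ i' j' → P i' j' →
        (i' ≡ i × j' ≡ j) ⊎ edgeLength i j ℕ.< edgeLength i' j')))
  ⊎ ((∀ i j → IsEdge σ₁ i j → ¬ P i j) × x₁ ≡ none)

Cases : {n : ℕ} → BRel (Fin n) → Decor n → BRel (Fin n) → Decor n → Set
Cases {n} σ₁ x₁ σ₂ x₂ =
  (x₁ ≡ none × x₂ ≡ none)
  ⊎ (∃[ a ] ∃[ b ] (x₂ ≡ edge a b × IsEdge σ₂ a b ×
       MinEdgeOrEmpty σ₁ (λ i j → toℕ i ℕ.≤ toℕ a × toℕ b ℕ.≤ toℕ j) x₁))
  ⊎ (∃[ B₂ ] ∃[ B₁ ] (x₂ ≡ block B₂ × IsBlock σ₂ B₂ ×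
       x₁ ≡ block B₁ × IsBlock σ₁ B₁ × B₁ ⊆ᵇ B₂))
  ⊎ (∃[ B₂ ] ∃[ i ] ∃[ j ] (x₂ ≡ block B₂ × IsBlock σ₂ B₂ ×
       x₁ ≡ edge i j × IsEdge σ₁ i j × T (B₂ i) × T (B₂ j)))
  -- (5)  i < min(x₂) ≤ max(x₂) < j, i.e. every element of x₂ lies strictly between i and j
  ⊎ (∃[ B₂ ] (x₂ ≡ block B₂ × IsBlock σ₂ B₂ ×
       MinEdgeOrEmpty σ₁ (λ i j → ∀ k → T (B₂ k) → toℕ i ℕ.< toℕ k × toℕ k ℕ.< toℕ j) x₁))

module Submission where

-- Write Same i j when i and j lie in one block of π, and Opp i j when i and −j do; π is
-- determined by these two relations on [n].  The blocks of π meeting both signs ("touching")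
-- are totally ordered, negation reverses the order, and rank i counts the touching blocks up to
-- that of i; so Opp i j holds exactly when i and j touch and rank i + rank j = m + 1.  Hence σ is
-- Same ∪ Opp, and x is nothing, the innermost link, or the zero block of π.
--
-- So π₁ ≤ π₂ means Same₁ ⊆ Same₂ and Opp₁ ⊆ Opp₂, which gives σ₁ ≤ σ₂ and, by noncrossing,
-- the case of the proposition determined by x₂.  Conversely σ₁ ≤ σ₂ leaves two possible
-- defects: a Same₁-pair that is only an Opp₂-pair, or an Opp₁-pair that is only a Same₂-pair.
-- Either would produce a σ₁-edge covering x₂ more tightly than x₁, or put a point into a
-- zero block, and the case in force excludes both.

open import Defs
open import Data.Bool using (Bool; true; false; T; not; _∧_)
open import Data.Bool.Properties using (T-∧; T-∨; ∧-assoc)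
open import Data.Bool.ListAction using (any)
open import Data.Empty using (⊥; ⊥-elim)
open import Data.Fin using (Fin; zero; suc; toℕ; _<_; _≤_)
import Data.Fin.Properties as Finₚ
open import Data.Fin.Permutation using (permutation)
open import Data.List using (allFin; filterᵇ; length; tabulate)
open import Data.List.Membership.Propositional using (lose)
open import Data.List.Membership.Propositional.Properties using (∈-allFin)
open import Data.List.Relation.Unary.Any using (satisfied)
open import Data.List.Relation.Unary.Any.Properties using (any⁺; any⁻)
open import Data.Nat using (ℕ; _+_)
import Data.Nat as ℕ
open import Data.Nat.DivMod using (m≡m%n+[m/n]*n; m*n/n≡m; m*n%n≡0; [m+kn]%n≡m%n)
import Data.Nat.Properties as ℕₚ
open import Data.Product using (∃; ∃-syntax; _×_; _,_; proj₁; proj₂)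
open import Data.Sum using (_⊎_; inj₁; inj₂)
open import Data.Unit using (tt)
open import Function.Base using (_∘_; case_of_)
open import Function.Bundles using (_⇔_; Equivalence; mk⇔)
open import Relation.Binary.Definitions using (tri<; tri≈; tri>)
open import Relation.Binary.PropositionalEquality
open import Relation.Nullary using (¬_; Dec; yes; no)
open import Relation.Nullary.Decidable using (T?)
open import Algebra.Properties.CommutativeMonoid.Sum ℕₚ.+-0-commutativeMonoid
  using (sum; sum-permute)

open Equivalence using (to; from)

T-ext : ∀ {a b} → (T a → T b) → (T b → T a) → a ≡ b
T-ext {true}  {true}  _ _ = refl
T-ext {true}  {false} f _ = ⊥-elim (f tt)
T-ext {false} {true}  _ g = ⊥-elim (g tt)
T-ext {false} {false} _ _ = refl

T-not : ∀ {a} → T (not a) → ¬ T a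
T-not {false} _ ()

not-T : ∀ {a} → ¬ T a → T (not a)
not-T {true}  ¬a = ¬a tt
not-T {false} _  = tt

any-allFin⁻ : ∀ {n} (p : Fin n → Bool) → T (any p (allFin n)) → ∃ (T ∘ p)
any-allFin⁻ {n} p = satisfied ∘ any⁻ p (allFin n)

any-allFin⁺ : ∀ {n} (p : Fin n → Bool) k → T (p k) → T (any p (allFin n))
any-allFin⁺ p k = any⁺ p ∘ lose (∈-allFin k)

module Counting where

  indicator : Bool → ℕ
  indicator true  = 1
  indicator false = 0

  count : ∀ {n} → (Fin n → Bool) → ℕ
  count p = sum (indicator ∘ p)

  length-filterᵇ-tabulate : ∀ {A : Set} n (f : Fin n → A) (p : A → Bool) →
    length (filterᵇ p (tabulate f)) ≡ count (p ∘ f)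
  length-filterᵇ-tabulate ℕ.zero    f p = refl
  length-filterᵇ-tabulate (ℕ.suc n) f p with p (f zero)
  ... | true  = cong ℕ.suc (length-filterᵇ-tabulate n (f ∘ suc) p)
  ... | false = length-filterᵇ-tabulate n (f ∘ suc) p

  length-filterᵇ-allFin : ∀ {n} (p : Fin n → Bool) → length (filterᵇ p (allFin n)) ≡ count p
  length-filterᵇ-allFin {n} p = length-filterᵇ-tabulate n (λ i → i) p

  count-cong : ∀ {n} {p q : Fin n → Bool} → (∀ i → p i ≡ q i) → count p ≡ count q
  count-cong {ℕ.zero}  eq = refl
  count-cong {ℕ.suc n} eq = cong₂ _+_ (cong indicator (eq zero)) (count-cong (eq ∘ suc))

  count-split : ∀ {n} (p q : Fin n → Bool) →
    count p ≡ count (λ i → p i ∧ q i) + count (λ i → p i ∧ not (q i))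
  count-split {ℕ.zero}  p q = refl
  count-split {ℕ.suc n} p q with p zero | q zero | count-split (p ∘ suc) (q ∘ suc)
  ... | true  | true  | eq = cong ℕ.suc eq
  ... | true  | false | eq = trans (cong ℕ.suc eq) (sym (ℕₚ.+-suc _ _))
  ... | false | _     | eq = eq

  indicator-mono : ∀ {a b} → (T a → T b) → indicator a ℕ.≤ indicator b
  indicator-mono {false}         _ = ℕ.z≤n
  indicator-mono {true} {true}   _ = ℕₚ.≤-refl
  indicator-mono {true} {false} f = ⊥-elim (f tt)

  indicator-mono-< : ∀ {a b} → ¬ T a → T b → indicator a ℕ.< indicator b
  indicator-mono-< {false} {true} _ _ = ℕₚ.≤-refl
  indicator-mono-< {true}         ¬a _ = ⊥-elim (¬a tt)

  count-mono : ∀ {n} {p q : Fin n → Bool} → (∀ i → T (p i) → T (q i)) → count p ℕ.≤ count q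
  count-mono {ℕ.zero}  p⊆q = ℕ.z≤n
  count-mono {ℕ.suc n} p⊆q = ℕₚ.+-mono-≤ (indicator-mono (p⊆q zero)) (count-mono (p⊆q ∘ suc))

  count-mono-< : ∀ {n} {p q : Fin n → Bool} → (∀ i → T (p i) → T (q i)) →
    ∀ k → ¬ T (p k) → T (q k) → count p ℕ.< count q
  count-mono-< p⊆q zero    ¬pk qk =
    ℕₚ.+-mono-<-≤ (indicator-mono-< ¬pk qk) (count-mono (p⊆q ∘ suc))
  count-mono-< p⊆q (suc k) ¬pk qk =
    ℕₚ.+-mono-≤-< (indicator-mono (p⊆q zero)) (count-mono-< (p⊆q ∘ suc) k ¬pk qk)

  count-pos : ∀ {n} {p : Fin n → Bool} k → T (p k) → 0 ℕ.< count p
  count-pos           zero    pk = ℕₚ.≤-trans (indicator-mono {true} (λ _ → pk)) (ℕₚ.m≤m+n _ _)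
  count-pos {p = p} (suc k) pk = ℕₚ.≤-trans (count-pos k pk) (ℕₚ.m≤n+m _ (indicator (p zero)))

  count-zero : ∀ {n} {p : Fin n → Bool} → (∀ i → ¬ T (p i)) → count p ≡ 0
  count-zero {ℕ.zero}      _  = refl
  count-zero {ℕ.suc n} {p} ¬p with p zero | ¬p zero
  ... | true  | ¬p0 = ⊥-elim (¬p0 tt)
  ... | false | _   = count-zero (¬p ∘ suc)

  count-unique : ∀ {n} {p : Fin n → Bool} k → T (p k) → (∀ i → T (p i) → i ≡ k) → count p ≡ 1
  count-unique {p = p} zero pk unique with p zero
  ... | true = cong ℕ.suc (count-zero λ i pi → case unique (suc i) pi of λ ())
  count-unique {p = p} (suc k) pk unique with p zero in p0
  ... | true  = case unique zero (subst T (sym p0) tt) of λ ()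
  ... | false = count-unique k pk (λ i pi → Finₚ.suc-injective (unique (suc i) pi))

  count-involution : ∀ {n} (p : Fin n → Bool) (h : Fin n → Fin n) →
    (∀ i → h (h i) ≡ i) → count (p ∘ h) ≡ count p
  count-involution p h involutive =
    sym (sum-permute (indicator ∘ p) (permutation h h involutive involutive))

  count-fixedPointFree-involution : ∀ {n} (p : Fin n → Bool) (h : Fin n → Fin n) →
    (∀ i → h (h i) ≡ i) → (∀ i → T (p i) → T (p (h i))) → (∀ i → T (p i) → h i ≢ i) →
    let c = count (λ i → p i ∧ (i <ᶠ h i)) in count p ≡ c + c
  count-fixedPointFree-involution p h involutive closed free = begin
    count p                                     ≡⟨ count-split p (λ i → i <ᶠ h i) ⟩
    count W + count (λ i → p i ∧ not (i <ᶠ h i)) ≡⟨ cong (count W +_) (count-cong swap) ⟩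
    count W + count (W ∘ h)                     ≡⟨ cong (count W +_) (count-involution W h involutive) ⟩
    count W + count W                           ∎
    where
    open ≡-Reasoning
    W : _ → Bool
    W i = p i ∧ (i <ᶠ h i)
    swap : ∀ i → p i ∧ not (i <ᶠ h i) ≡ W (h i)
    swap i = T-ext to-W from-W
      where
      to-W : T (p i ∧ not (i <ᶠ h i)) → T (W (h i))
      to-W x = let pi , ¬i<hi = to T-∧ x
                   hi≤i = ℕₚ.≮⇒≥ (T-not ¬i<hi ∘ ℕₚ.<⇒<ᵇ)
                   hi<i = Finₚ.≤∧≢⇒< hi≤i (free i pi)
               in from T-∧ (closed i pi , ℕₚ.<⇒<ᵇ (subst (h i <_) (sym (involutive i)) hi<i))
      from-W : T (W (h i)) → T (p i ∧ not (i <ᶠ h i))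
      from-W y = let phi , hi<hhi = to T-∧ y
                     hi<i = subst (h i <_) (involutive i) (ℕₚ.<ᵇ⇒< _ _ hi<hhi)
                 in from T-∧ (subst (T ∘ p) (involutive i) (closed (h i) phi) ,
                               not-T (ℕₚ.<-asym hi<i ∘ ℕₚ.<ᵇ⇒< _ _))

record Greatest {n} (p : Fin n → Bool) : Set where
  constructor greatest
  field
    elem  : Fin n
    holds : T (p elem)
    bound : ∀ j → T (p j) → j ≤ elem

record Least {n} (p : Fin n → Bool) : Set where
  constructor least
  field
    elem  : Fin n
    holds : T (p elem)
    bound : ∀ j → T (p j) → elem ≤ j

greatest? : ∀ {n} (p : Fin n → Bool) → (∀ j → ¬ T (p j)) ⊎ Greatest p
greatest? {ℕ.zero}  p = inj₁ λ ()
greatest? {ℕ.suc n} p with greatest? (p ∘ suc) | T? (p zero)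
... | inj₂ (greatest t pt bd) | _ =
  inj₂ (greatest (suc t) pt λ { zero _ → ℕ.z≤n ; (suc j) pj → ℕ.s≤s (bd j pj) })
... | inj₁ absent | yes p0 =
  inj₂ (greatest zero p0 λ { zero _ → ℕ.z≤n ; (suc j) pj → ⊥-elim (absent j pj) })
... | inj₁ absent | no ¬p0 = inj₁ λ { zero → ¬p0 ; (suc j) → absent j }

least? : ∀ {n} (p : Fin n → Bool) → (∀ j → ¬ T (p j)) ⊎ Least p
least? {ℕ.zero}  p = inj₁ λ ()
least? {ℕ.suc n} p with T? (p zero) | least? (p ∘ suc)
... | yes p0 | _ = inj₂ (least zero p0 λ _ _ → ℕ.z≤n)
... | no ¬p0 | inj₂ (least t pt bd) =
  inj₂ (least (suc t) pt λ { zero p0 → ⊥-elim (¬p0 p0) ; (suc j) pj → ℕ.s≤s (bd j pj) })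
... | no ¬p0 | inj₁ absent = inj₁ λ { zero → ¬p0 ; (suc j) → absent j }

greatestOf : ∀ {n} (p : Fin n → Bool) k → T (p k) → Greatest p
greatestOf p k pk with greatest? p
... | inj₁ absent = ⊥-elim (absent k pk)
... | inj₂ g      = g

leastOf : ∀ {n} (p : Fin n → Bool) k → T (p k) → Least p
leastOf p k pk with least? p
... | inj₁ absent = ⊥-elim (absent k pk)
... | inj₂ l      = l

module Parity where

  open import Data.Nat using (_*_; _%_; _/_; suc)

  double≡*2 : ∀ r → r + r ≡ r * 2
  double≡*2 r = trans (cong (r +_) (sym (ℕₚ.+-identityʳ r))) (ℕₚ.*-comm 2 r)

  even⇒double-half : ∀ m → m % 2 ≡ 0 → m / 2 + m / 2 ≡ m
  even⇒double-half m even = sym (begin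
    m                     ≡⟨ m≡m%n+[m/n]*n m 2 ⟩
    m % 2 + m / 2 * 2     ≡⟨ cong (_+ m / 2 * 2) even ⟩
    m / 2 * 2             ≡⟨ double≡*2 (m / 2) ⟨
    m / 2 + m / 2         ∎)
    where open ≡-Reasoning

  odd⇒suc-double-half : ∀ m → m % 2 ≡ 1 → suc (m / 2 + m / 2) ≡ m
  odd⇒suc-double-half m odd = sym (begin
    m                     ≡⟨ m≡m%n+[m/n]*n m 2 ⟩
    m % 2 + m / 2 * 2     ≡⟨ cong (_+ m / 2 * 2) odd ⟩
    suc (m / 2 * 2)       ≡⟨ cong suc (double≡*2 (m / 2)) ⟨
    suc (m / 2 + m / 2)   ∎)
    where open ≡-Reasoning

  odd⇒half-suc : ∀ m → m % 2 ≡ 1 → suc m / 2 ≡ suc (m / 2)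
  odd⇒half-suc m odd = begin
    suc m / 2                          ≡⟨ cong (λ k → suc k / 2) (odd⇒suc-double-half m odd) ⟨
    suc (suc (m / 2 + m / 2)) / 2      ≡⟨ cong (λ k → suc k / 2) (ℕₚ.+-suc (m / 2) (m / 2)) ⟨
    (suc (m / 2) + suc (m / 2)) / 2    ≡⟨ cong (_/ 2) (double≡*2 (suc (m / 2))) ⟩
    suc (m / 2) * 2 / 2                ≡⟨ m*n/n≡m (suc (m / 2)) 2 ⟩
    suc (m / 2)                        ∎
    where open ≡-Reasoning

  double≢odd : ∀ r q → r + r ≢ suc (q + q)
  double≢odd r q eq = ℕₚ.0≢1+n (begin
    0                  ≡⟨ m*n%n≡0 r 2 ⟨
    r * 2 % 2          ≡⟨ cong (_% 2) (double≡*2 r) ⟨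
    (r + r) % 2        ≡⟨ cong (_% 2) eq ⟩
    suc (q + q) % 2    ≡⟨ cong (λ k → suc k % 2) (double≡*2 q) ⟩
    (1 + q * 2) % 2    ≡⟨ [m+kn]%n≡m%n 1 q 2 ⟩
    1                  ∎)
    where open ≡-Reasoning

  double-injective : ∀ r s → r + r ≡ s + s → r ≡ s
  double-injective r s eq =
    ℕₚ.*-cancelʳ-≡ r s 2 (trans (sym (double≡*2 r)) (trans eq (double≡*2 s)))

≤⇒<⊎≡ : ∀ {n} {i j : Fin n} → i ≤ j → i < j ⊎ i ≡ j
≤⇒<⊎≡ i≤j with ℕₚ.m≤n⇒m<n∨m≡n i≤j
... | inj₁ i<j = inj₁ i<j
... | inj₂ i≡j = inj₂ (Finₚ.toℕ-injective i≡j)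

edgeLength-mono : ∀ {n} {i j i′ j′ : Fin n} → i ≤ i′ → j′ ≤ j → edgeLength i′ j′ ℕ.≤ edgeLength i j
edgeLength-mono i≤i′ j′≤j = ℕₚ.∸-mono j′≤j i≤i′

nested-shorter : ∀ {n} {i j c d : Fin n} → i ≤ c → c < d → d ≤ j →
  (i ≡ c × j ≡ d) ⊎ edgeLength c d ℕ.< edgeLength i j
nested-shorter {i = i} {j} {c} {d} i≤c c<d d≤j with ≤⇒<⊎≡ i≤c | ≤⇒<⊎≡ d≤j
... | inj₁ i<c  | _         =
  inj₂ (ℕₚ.<-≤-trans (ℕₚ.∸-monoʳ-< i<c (ℕₚ.<⇒≤ c<d)) (ℕₚ.∸-monoˡ-≤ (toℕ i) d≤j))
... | inj₂ refl | inj₁ d<j  = inj₂ (ℕₚ.∸-monoˡ-< d<j (ℕₚ.<⇒≤ c<d))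
... | inj₂ refl | inj₂ refl = inj₁ (refl , refl)

module Geometry {n : ℕ} (π : NCB n) where

  open ψ-construction π public
  open IsEquivalenceᵇ (isEquivB π)
  open Counting

  Same Opp : Fin n → Fin n → Set
  Same i j = T (relB π (pos , i) (pos , j))
  Opp  i j = T (relB π (pos , i) (neg , j))

  Zero : Fin n → Set
  Zero i = Opp i i

  NoZero : Set
  NoZero = ∀ i → ¬ Zero i

  Gap : Fin n → Fin n → Set
  Gap a b = ∀ k l → a < k → k < b → ¬ Opp k l

  private variable a b c d i j k l s t : Fin n

  Same-refl : ∀ i → Same i i
  Same-refl i = reflᵇ (pos , i)

  Same-sym : Same i j → Same j i
  Same-sym = symᵇ _ _

  Same-trans : Same i j → Same j k → Same i k
  Same-trans = transᵇ _ _ _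

  Same-≡ : i ≡ j → Same i j
  Same-≡ refl = Same-refl _

  Opp-sym : Opp i j → Opp j i
  Opp-sym {i} {j} o = subst T (symmB π (pos , j) (neg , i)) (symᵇ _ _ o)

  Same-Opp : Same i j → Opp j k → Opp i k
  Same-Opp = transᵇ _ _ _

  Opp-Same : Opp i k → Same k l → Opp i l
  Opp-Same {k = k} {l} o s = transᵇ _ _ _ o (subst T (sym (symmB π (pos , k) (pos , l))) s)

  Opp-Opp⇒Sameˡ : Opp i k → Opp j k → Same i j
  Opp-Opp⇒Sameˡ o o′ = transᵇ _ _ _ o (symᵇ _ _ o′)

  Opp-Opp⇒Sameʳ : Opp i k → Opp i l → Same k l
  Opp-Opp⇒Sameʳ o o′ = Opp-Opp⇒Sameˡ (Opp-sym o) (Opp-sym o′)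

  Zero-Same : Zero i → Zero j → Same i j
  Zero-Same = zeroB π _ _

  Zero-resp-Same : Same i j → Zero i → Zero j
  Zero-resp-Same s z = Opp-Same (Same-Opp (Same-sym s) z) s

  Zero-Opp : Zero i → Opp i j → Zero j
  Zero-Opp z o = Zero-resp-Same (Opp-Opp⇒Sameʳ z o) z

  noncrossing-SO : i < j → j < k → Same i k → Opp j s → Same i j
  noncrossing-SO {k = k} {s = s} i<j j<k =
    noncrB π _ _ _ (neg , s) i<j j<k (ℕₚ.<-≤-trans (Finₚ.toℕ<n k) (ℕₚ.m≤m+n n (toℕ s)))

  noncrossing-OO : i < j → s < t → Opp i s → Opp j t → Same i j
  noncrossing-OO {j = j} {s = s} i<j s<t =
    noncrB π _ _ (neg , s) _ i<j (ℕₚ.<-≤-trans (Finₚ.toℕ<n j) (ℕₚ.m≤m+n n (toℕ s)))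
      (ℕₚ.+-monoʳ-< n s<t)

  touch⇒Opp : T (touch i) → ∃ (Opp i)
  touch⇒Opp = any-allFin⁻ _

  Opp⇒touch : Opp i k → T (touch i)
  Opp⇒touch {i} {k} = any-allFin⁺ (λ k → relB π (pos , i) (neg , k)) k

  touch-resp-Same : Same i j → T (touch i) → T (touch j)
  touch-resp-Same s ti = Opp⇒touch (Same-Opp (Same-sym s) (proj₂ (touch⇒Opp ti)))

  isMax⇒ : T (isMax t) → Same t j → j ≤ t
  isMax⇒ {t} {j} max s with ℕₚ.≤-<-connex (toℕ j) (toℕ t)
  ... | inj₁ j≤t = j≤t
  ... | inj₂ t<j = ⊥-elim (T-not max (any-allFin⁺ _ j (from T-∧ (s , ℕₚ.<⇒<ᵇ t<j))))

  ⇒isMax : (∀ j → Same t j → j ≤ t) → T (isMax t)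
  ⇒isMax bound = not-T λ above → let j , sj = any-allFin⁻ _ above ; s , t<j = to T-∧ sj in
    ℕₚ.<⇒≱ (ℕₚ.<ᵇ⇒< _ _ t<j) (bound j s)

  isMin⇒ : T (isMin t) → Same t j → t ≤ j
  isMin⇒ {t} {j} min s with ℕₚ.≤-<-connex (toℕ t) (toℕ j)
  ... | inj₁ t≤j = t≤j
  ... | inj₂ j<t = ⊥-elim (T-not min (any-allFin⁺ _ j (from T-∧ (s , ℕₚ.<⇒<ᵇ j<t))))

  blockMax : ∀ i → Greatest (η i)
  blockMax i = greatestOf (η i) i (Same-refl i)

  isTouchingMax : Fin n → Bool
  isTouchingMax t = touch t ∧ isMax t

  reaches : Fin n → Fin n → Bool
  reaches i t = any (λ k → η i k ∧ (t ≤ᶠ k)) (allFin n)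

  reaches⇒ : T (reaches i t) → ∃[ k ] Same i k × t ≤ k
  reaches⇒ r = let k , x = any-allFin⁻ _ r ; s , t≤k = to T-∧ x in k , s , ℕₚ.≤ᵇ⇒≤ _ _ t≤k

  ⇒reaches : Same i k → t ≤ k → T (reaches i t)
  ⇒reaches {k = k} s t≤k = any-allFin⁺ _ k (from T-∧ (s , ℕₚ.≤⇒≤ᵇ t≤k))

  reaches-resp-Same : Same i j → T (reaches i t) → T (reaches j t)
  reaches-resp-Same {i} {t = t} s r =
    let k , i~k , t≤k = reaches⇒ {i} {t} r in ⇒reaches (Same-trans (Same-sym s) i~k) t≤k

  m≡count : m ≡ count isTouchingMax
  m≡count = length-filterᵇ-allFin isTouchingMax

  rank≡count : ∀ i → rank i ≡ count (λ t → isTouchingMax t ∧ reaches i t)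
  rank≡count i = trans (length-filterᵇ-allFin (λ t → touch t ∧ (isMax t ∧ reaches i t)))
    (count-cong λ t → sym (∧-assoc (touch t) (isMax t) (reaches i t)))

  blockMax-isTouchingMax : T (touch i) → T (isTouchingMax (Greatest.elem (blockMax i)))
  blockMax-isTouchingMax {i} ti with blockMax i
  ... | greatest M sM bound =
    from T-∧ (touch-resp-Same sM ti , ⇒isMax λ j s → bound j (Same-trans sM s))

  -- A touching block lying between two points of another block would cross it on its way to the
  -- negative half.
  touching-blocks-ordered : T (touch i) → T (touch j) → ¬ Same i j → i < j →
    Same i k → Same j l → k < l
  touching-blocks-ordered {i} {j} {k} {l} ti tj ¬s i<j i~k j~l with Finₚ.<-cmp k l
  ... | tri< k<l _ _ = k<l
  ... | tri≈ _ refl _ = ⊥-elim (¬s (Same-trans i~k (Same-sym j~l)))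
  ... | tri> _ _ l<k with Finₚ.<-cmp j k
  ...   | tri< j<k _ _ = ⊥-elim (¬s (noncrossing-SO i<j j<k i~k (proj₂ (touch⇒Opp tj))))
  ...   | tri≈ _ refl _ = ⊥-elim (¬s i~k)
  ...   | tri> _ _ k<j = ⊥-elim (¬s (Same-trans i~k (Same-trans (Same-sym l~k) (Same-sym j~l))))
    where l~k = noncrossing-SO l<k k<j (Same-sym j~l) (proj₂ (touch⇒Opp (touch-resp-Same i~k ti)))

  Opp-antitone : ¬ Same i j → i < j → Opp i k → Opp j l → l < k
  Opp-antitone {k = k} {l} ¬s i<j ik jl with Finₚ.<-cmp k l
  ... | tri< k<l _ _ = ⊥-elim (¬s (noncrossing-OO i<j k<l ik jl))
  ... | tri≈ _ refl _ = ⊥-elim (¬s (Opp-Opp⇒Sameˡ ik jl))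
  ... | tri> _ _ l<k = l<k

  rank-resp-Same : Same i j → rank i ≡ rank j
  rank-resp-Same {i} {j} s = begin
    rank i                                         ≡⟨ rank≡count i ⟩
    count (λ t → isTouchingMax t ∧ reaches i t)   ≡⟨ count-cong reach≡ ⟩
    count (λ t → isTouchingMax t ∧ reaches j t)   ≡⟨ rank≡count j ⟨
    rank j                                         ∎
    where
    open ≡-Reasoning
    reach≡ : ∀ t → isTouchingMax t ∧ reaches i t ≡ isTouchingMax t ∧ reaches j t
    reach≡ t = cong (isTouchingMax t ∧_)
      (T-ext (reaches-resp-Same {t = t} s) (reaches-resp-Same {t = t} (Same-sym s)))

  rank-mono-< : T (touch i) → T (touch j) → ¬ Same i j → i < j → rank i ℕ.< rank j
  rank-mono-< {i} {j} ti tj ¬s i<j = subst₂ ℕ._<_ (sym (rank≡count i)) (sym (rank≡count j))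
    (count-mono-< reach-mono M (¬reaches-M ∘ proj₂ ∘ to T-∧)
      (from T-∧ (blockMax-isTouchingMax tj , ⇒reaches sM ℕₚ.≤-refl)))
    where
    open Greatest (blockMax j) renaming (elem to M; holds to sM; bound to M-bound)
    below-j : Same i k → k < j
    below-j i~k = touching-blocks-ordered ti tj ¬s i<j i~k (Same-refl j)
    reach-mono : ∀ t → T (isTouchingMax t ∧ reaches i t) → T (isTouchingMax t ∧ reaches j t)
    reach-mono t x = let tm , r = to T-∧ x ; k , i~k , t≤k = reaches⇒ {i} {t} r in
      from T-∧ (tm , ⇒reaches (Same-refl j) (ℕₚ.≤-trans t≤k (ℕₚ.<⇒≤ (below-j i~k))))
    ¬reaches-M : ¬ T (reaches i M)
    ¬reaches-M r = let k , i~k , M≤k = reaches⇒ {i} {M} r in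
      ℕₚ.<⇒≱ (below-j i~k) (ℕₚ.≤-trans (M-bound j (Same-refl j)) M≤k)

  rank-injective : T (touch i) → T (touch j) → rank i ≡ rank j → Same i j
  rank-injective {i} {j} ti tj eq with T? (η i j)
  ... | yes s = s
  ... | no ¬s with Finₚ.<-cmp i j
  ...   | tri< i<j _ _ = ⊥-elim (ℕₚ.<⇒≢ (rank-mono-< ti tj ¬s i<j) eq)
  ...   | tri≈ _ refl _ = ⊥-elim (¬s (Same-refl i))
  ...   | tri> _ _ j<i = ⊥-elim (ℕₚ.<⇒≢ (rank-mono-< tj ti (¬s ∘ Same-sym) j<i) (sym eq))

  oppMax : T (touch t) → Greatest (λ j → relB π (pos , t) (neg , j))
  oppMax t-touches = let k , o = touch⇒Opp t-touches in greatestOf _ k o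

  -- Pairs the maxima of the touching blocks B and −B ∩ [n]; the identity elsewhere.
  mirror : Fin n → Fin n
  mirror t with T? (isTouchingMax t)
  ... | yes tm = Greatest.elem (oppMax (proj₁ (to T-∧ tm)))
  ... | no _   = t

  mirror-Opp : T (isTouchingMax t) → Opp t (mirror t) × (∀ j → Opp t j → j ≤ mirror t)
  mirror-Opp {t} tm with T? (isTouchingMax t)
  ... | yes tm′ = let open Greatest (oppMax (proj₁ (to T-∧ tm′))) in holds , bound
  ... | no ¬tm  = ⊥-elim (¬tm tm)

  mirror-id : ¬ T (isTouchingMax t) → mirror t ≡ t
  mirror-id {t} ¬tm with T? (isTouchingMax t)
  ... | yes tm = ⊥-elim (¬tm tm)
  ... | no _   = refl

  mirror-isTouchingMax : T (isTouchingMax t) → T (isTouchingMax (mirror t))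
  mirror-isTouchingMax tm = let o , bound = mirror-Opp tm in
    from T-∧ (Opp⇒touch (Opp-sym o) , ⇒isMax λ j s → bound j (Opp-Same o s))

  mirror-involutive-touching : T (isTouchingMax t) → mirror (mirror t) ≡ t
  mirror-involutive-touching {t} tm = Finₚ.≤-antisym
    (isMax⇒ (proj₂ (to T-∧ tm)) (Opp-Opp⇒Sameʳ (Opp-sym t~mt) mt~mmt))
    (mmt-bound t (Opp-sym t~mt))
    where
    t~mt = proj₁ (mirror-Opp tm)
    mt~mmt = proj₁ (mirror-Opp (mirror-isTouchingMax tm))
    mmt-bound = proj₂ (mirror-Opp (mirror-isTouchingMax tm))

  mirror-involutive : ∀ t → mirror (mirror t) ≡ t
  mirror-involutive t = case T? (isTouchingMax t) of λ where
    (yes tm) → mirror-involutive-touching tm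
    (no ¬tm) → trans (cong mirror (mirror-id ¬tm)) (mirror-id ¬tm)

  isTouchingMax-mirror⁻ : T (isTouchingMax (mirror t)) → T (isTouchingMax t)
  isTouchingMax-mirror⁻ {t} tm = case T? (isTouchingMax t) of λ where
    (yes tm′) → tm′
    (no ¬tm)  → ⊥-elim (¬tm (subst (T ∘ isTouchingMax) (mirror-id ¬tm) tm))

  after before : Fin n → Fin n → Bool
  after  i t = isTouchingMax t ∧ not (reaches i t)
  before j t = isTouchingMax t ∧ (reaches j t ∧ not (η t j))

  after⇒mirror-before : Opp i j → T (isTouchingMax t) → ¬ T (reaches i t) → T (before j (mirror t))
  after⇒mirror-before {i} {j} {t} o tm ¬reach =
    from T-∧ (mirror-isTouchingMax tm ,
      from T-∧ (⇒reaches (Same-refl j) (ℕₚ.<⇒≤ mt<j) , not-T ¬mt~j))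
    where
    ¬i~t : ¬ Same i t
    ¬i~t s = ¬reach (⇒reaches s ℕₚ.≤-refl)
    t~mt = proj₁ (mirror-Opp tm)
    mt<j : mirror t < j
    mt<j = Opp-antitone ¬i~t (ℕₚ.≰⇒> (¬reach ∘ ⇒reaches (Same-refl i))) o t~mt
    ¬mt~j : ¬ Same (mirror t) j
    ¬mt~j s = ¬i~t (Opp-Opp⇒Sameˡ o (Opp-Same t~mt s))

  mirror-before⇒after : Opp i j → T (isTouchingMax t) →
    Same j k → mirror t ≤ k → ¬ Same (mirror t) j → ¬ T (reaches i t)
  mirror-before⇒after {i} {j} {t} {k} o tm j~k mt≤k ¬mt~j r =
    let k′ , i~k′ , t≤k′ = reaches⇒ {i} {t} r in
    ℕₚ.<⇒≱ (touching-blocks-ordered (Opp⇒touch o) (proj₁ (to T-∧ tm)) ¬i~t i<t i~k′ (Same-refl t))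
            t≤k′
    where
    t~mt = proj₁ (mirror-Opp tm)
    ¬mt~k : ¬ Same (mirror t) k
    ¬mt~k s = ¬mt~j (Same-trans s (Same-sym j~k))
    i<t : i < t
    i<t = Opp-antitone ¬mt~k (Finₚ.≤∧≢⇒< mt≤k (¬mt~k ∘ Same-≡))
            (Opp-sym t~mt) (Same-Opp (Same-sym j~k) (Opp-sym o))
    ¬i~t : ¬ Same i t
    ¬i~t s = ¬mt~j (Same-sym (Opp-Opp⇒Sameʳ (Same-Opp (Same-sym s) o) t~mt))

  count-after≡count-before : Opp i j → count (after i) ≡ count (before j)
  count-after≡count-before {i} {j} o =
    trans (count-cong λ t → T-ext (to-before t) (to-after t))
          (count-involution (before j) mirror mirror-involutive)
    where
    to-before : ∀ t → T (after i t) → T (before j (mirror t))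
    to-before t x = let tm , ¬r = to T-∧ x in after⇒mirror-before o tm (T-not ¬r)
    to-after : ∀ t → T (before j (mirror t)) → T (after i t)
    to-after t y =
      let mtm , y′ = to T-∧ y ; r , ¬s = to T-∧ y′
          k , j~k , mt≤k = reaches⇒ {j} {mirror t} r
          tm = isTouchingMax-mirror⁻ mtm
      in from T-∧ (tm , not-T (mirror-before⇒after o tm j~k mt≤k (T-not ¬s)))

  rank≡suc-count-before : T (touch j) → rank j ≡ ℕ.suc (count (before j))
  rank≡suc-count-before {j} tj = begin
    rank j                                                       ≡⟨ rank≡count j ⟩
    count R                                                      ≡⟨ count-split R (λ t → η t j) ⟩
    count (λ t → R t ∧ η t j) + count (λ t → R t ∧ not (η t j))
      ≡⟨ cong₂ _+_ own-block (count-cong reassoc) ⟩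
    1 + count (before j)                                         ∎
    where
    open ≡-Reasoning
    open Greatest (blockMax j) renaming (elem to M; holds to j~M; bound to M-bound)
    R : Fin n → Bool
    R t = isTouchingMax t ∧ reaches j t
    only-M : ∀ t → T (R t ∧ η t j) → t ≡ M
    only-M t x = let r , t~j = to (T-∧ {R t}) x ; tm = proj₁ (to (T-∧ {isTouchingMax t}) r) in
      Finₚ.≤-antisym (M-bound t (Same-sym t~j)) (isMax⇒ (proj₂ (to T-∧ tm)) (Same-trans t~j j~M))
    own-block : count (λ t → R t ∧ η t j) ≡ 1
    own-block = count-unique M
      (from T-∧ (from T-∧ (blockMax-isTouchingMax tj , ⇒reaches j~M ℕₚ.≤-refl) , Same-sym j~M))
      only-M
    reassoc : ∀ t → R t ∧ not (η t j) ≡ before j t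
    reassoc t = ∧-assoc (isTouchingMax t) (reaches j t) (not (η t j))

  Opp⇒rank-sum : Opp i j → rank i + rank j ≡ ℕ.suc m
  Opp⇒rank-sum {i} {j} o = begin
    rank i + rank j                     ≡⟨ cong₂ _+_ (rank≡count i) (rank≡suc-count-before tj) ⟩
    count R + ℕ.suc (count (before j))  ≡⟨ ℕₚ.+-suc (count R) _ ⟩
    ℕ.suc (count R + count (before j))  ≡⟨ cong (ℕ.suc ∘ (count R +_)) (count-after≡count-before o) ⟨
    ℕ.suc (count R + count (after i))   ≡⟨ cong ℕ.suc (count-split isTouchingMax (reaches i)) ⟨
    ℕ.suc (count isTouchingMax)         ≡⟨ cong ℕ.suc m≡count ⟨
    ℕ.suc m                             ∎
    where
    open ≡-Reasoning
    R : Fin n → Bool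
    R t = isTouchingMax t ∧ reaches i t
    tj = Opp⇒touch (Opp-sym o)

  rank-sum⇒Opp : T (touch i) → T (touch j) → rank i + rank j ≡ ℕ.suc m → Opp i j
  rank-sum⇒Opp {i} {j} ti tj eq = let k , o = touch⇒Opp ti in
    Opp-Same o (rank-injective (Opp⇒touch (Opp-sym o)) tj
      (ℕₚ.+-cancelˡ-≡ (rank i) _ _ (trans (Opp⇒rank-sum o) (sym eq))))

  σ⇒ : T (σ i j) → Same i j ⊎ Opp i j
  σ⇒ {i} {j} x with to (T-∨ {η i j}) x
  ... | inj₁ s = inj₁ s
  ... | inj₂ y = let ti , y′ = to (T-∧ {touch i}) y ; tj , eq = to (T-∧ {touch j}) y′ in
    inj₂ (rank-sum⇒Opp ti tj (ℕₚ.≡ᵇ⇒≡ _ _ eq))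

  Same⇒σ : Same i j → T (σ i j)
  Same⇒σ s = from T-∨ (inj₁ s)

  Opp⇒σ : Opp i j → T (σ i j)
  Opp⇒σ o = from T-∨ (inj₂ (from T-∧ (Opp⇒touch o ,
    from T-∧ (Opp⇒touch (Opp-sym o) , ℕₚ.≡⇒≡ᵇ _ _ (Opp⇒rank-sum o)))))

  σ-refl : ∀ i → T (σ i i)
  σ-refl i = Same⇒σ (Same-refl i)

  σ-sym : T (σ i j) → T (σ j i)
  σ-sym x with σ⇒ x
  ... | inj₁ s = Same⇒σ (Same-sym s)
  ... | inj₂ o = Opp⇒σ (Opp-sym o)

  σ-trans : T (σ i j) → T (σ j k) → T (σ i k)
  σ-trans x y with σ⇒ x | σ⇒ y
  ... | inj₁ s | inj₁ s′ = Same⇒σ (Same-trans s s′)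
  ... | inj₁ s | inj₂ o′ = Opp⇒σ (Same-Opp s o′)
  ... | inj₂ o | inj₁ s′ = Opp⇒σ (Opp-Same o s′)
  ... | inj₂ o | inj₂ o′ = Same⇒σ (Opp-Opp⇒Sameˡ o (Opp-sym o′))

  m≡0⇒no-Opp : m ≡ 0 → ∀ i k → ¬ Opp i k
  m≡0⇒no-Opp m≡0 i k o = ℕₚ.<⇒≢
    (count-pos {p = isTouchingMax} _ (blockMax-isTouchingMax (Opp⇒touch o)))
    (sym (trans (sym m≡count) m≡0))

  NoZero⇒m-even : NoZero → ∃ λ c → m ≡ c + c
  NoZero⇒m-even noZero = count (λ t → isTouchingMax t ∧ (t <ᶠ mirror t)) , trans m≡count
    (count-fixedPointFree-involution isTouchingMax mirror mirror-involutive
      (λ _ → mirror-isTouchingMax)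
      (λ t tm mt≡t → noZero t (subst (Opp t) mt≡t (proj₁ (mirror-Opp tm)))))

  odd⇒Zero : m ℕ.% 2 ≡ 1 → ∃ Zero
  odd⇒Zero odd with Finₚ.any? (λ z → T? (relB π (pos , z) (neg , z)))
  ... | yes z = z
  ... | no ¬z = let c , m≡c+c = NoZero⇒m-even (λ z zz → ¬z (z , zz)) in
    ⊥-elim (Parity.double≢odd c (m ℕ./ 2)
      (trans (sym m≡c+c) (sym (Parity.odd⇒suc-double-half m odd))))

  even⇒NoZero : m ℕ.% 2 ≡ 0 → NoZero
  even⇒NoZero even z zz = Parity.double≢odd (rank z) (m ℕ./ 2)
    (trans (Opp⇒rank-sum zz) (cong ℕ.suc (sym (Parity.even⇒double-half m even))))

  ψx-edge⇒innermost : m ℕ.% 2 ≡ 0 →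
    T (touch a) → T (isMax a) → rank a ≡ m ℕ./ 2 →
    T (touch b) → T (isMin b) → rank b ≡ ℕ.suc (m ℕ./ 2) →
    a < b × Opp a b × Gap a b
  ψx-edge⇒innermost {a} {b} even ta a-max ra tb b-min rb = a<b , a~b , gap
    where
    q = m ℕ./ 2
    ra<rb : rank a ℕ.< rank b
    ra<rb = subst₂ ℕ._<_ (sym ra) (sym rb) (ℕₚ.n<1+n q)
    ¬a~b : ¬ Same a b
    ¬a~b s = ℕₚ.<⇒≢ ra<rb (rank-resp-Same s)
    a~b : Opp a b
    a~b = rank-sum⇒Opp ta tb (begin
      rank a + rank b   ≡⟨ cong₂ _+_ ra rb ⟩
      q + ℕ.suc q       ≡⟨ ℕₚ.+-suc q q ⟩
      ℕ.suc (q + q)     ≡⟨ cong ℕ.suc (Parity.even⇒double-half m even) ⟩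
      ℕ.suc m           ∎)
      where open ≡-Reasoning
    a<b : a < b
    a<b with Finₚ.<-cmp a b
    ... | tri< a<b _ _  = a<b
    ... | tri≈ _ refl _ = ⊥-elim (¬a~b (Same-refl a))
    ... | tri> _ _ b<a  = ⊥-elim (ℕₚ.<-asym ra<rb (rank-mono-< tb ta (¬a~b ∘ Same-sym) b<a))
    -- A touching k strictly between a and b would have rank a < rank k < rank b = rank a + 1.
    gap : Gap a b
    gap k l a<k k<b k~l = ℕₚ.<⇒≱ (rank-mono-< tk tb ¬k~b k<b)
      (subst (ℕ._≤ rank k) (trans (cong ℕ.suc ra) (sym rb)) (rank-mono-< ta tk ¬a~k a<k))
      where
      tk = Opp⇒touch k~l
      ¬a~k : ¬ Same a k
      ¬a~k s = ℕₚ.<⇒≱ a<k (isMax⇒ a-max s)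
      ¬k~b : ¬ Same k b
      ¬k~b s = ℕₚ.<⇒≱ k<b (isMin⇒ b-min (Same-sym s))

  ZeroBlock : (Fin n → Bool) → Set
  ZeroBlock B = ∀ i → B i ≡ relB π (pos , i) (neg , i)

  ψx-block⇒ZeroBlock : ∀ {B} → m ℕ.% 2 ≡ 1 →
    (∀ i → B i ≡ (touch i ∧ (rank i ℕ.≡ᵇ ℕ.suc m ℕ./ 2))) → ZeroBlock B
  ψx-block⇒ZeroBlock {B} odd B≡ i = trans (B≡ i) (T-ext to-Zero from-Zero)
    where
    q = m ℕ./ 2
    double-suc-q : ℕ.suc q + ℕ.suc q ≡ ℕ.suc m
    double-suc-q = cong ℕ.suc (trans (ℕₚ.+-suc q q) (Parity.odd⇒suc-double-half m odd))
    half : ℕ.suc m ℕ./ 2 ≡ ℕ.suc q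
    half = Parity.odd⇒half-suc m odd
    to-Zero : T (touch i ∧ (rank i ℕ.≡ᵇ ℕ.suc m ℕ./ 2)) → Zero i
    to-Zero x = let ti , e = to (T-∧ {touch i}) x ; ri = trans (ℕₚ.≡ᵇ⇒≡ (rank i) _ e) half in
      rank-sum⇒Opp {i} {i} ti ti (trans (cong₂ _+_ ri ri) double-suc-q)
    from-Zero : Zero i → T (touch i ∧ (rank i ℕ.≡ᵇ ℕ.suc m ℕ./ 2))
    from-Zero z = from T-∧ (Opp⇒touch z , ℕₚ.≡⇒≡ᵇ (rank i) _
      (trans (Parity.double-injective (rank i) (ℕ.suc q)
                (trans (Opp⇒rank-sum z) (sym double-suc-q)))
             (sym half)))

  data View : Decor n → Set where
    none  : (∀ i k → ¬ Opp i k) → View none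
    edge  : ∀ {a b} → NoZero → a < b → Opp a b → Gap a b → View (edge a b)
    block : ∀ {B} z → ZeroBlock B → Zero z → View (block B)

  view : ∀ {x} → ψx π x → View x
  view (x-empty m≡0) = none (m≡0⇒no-Opp m≡0)
  view (x-edge a b even _ ta a-max ra tb b-min rb) =
    let a<b , a~b , gap = ψx-edge⇒innermost even ta a-max ra tb b-min rb in
    edge (even⇒NoZero even) a<b a~b gap
  view (x-block B odd B≡) = let z , zz = odd⇒Zero odd in block z (ψx-block⇒ZeroBlock odd B≡) zz

  Opp-under-block⇒Zero : Same i j → i ≤ k → k < l → l ≤ j → Opp k l → Zero l
  Opp-under-block⇒Zero {i} {j} {k} {l} i~j i≤k k<l l≤j k~l = Same-Opp (Same-sym k~l′) k~l
    where
    i~k : Same i k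
    i~k with ≤⇒<⊎≡ i≤k
    ... | inj₁ i<k  = noncrossing-SO i<k (ℕₚ.<-≤-trans k<l l≤j) i~j k~l
    ... | inj₂ refl = Same-refl i
    k~l′ : Same k l
    k~l′ with ≤⇒<⊎≡ l≤j
    ... | inj₁ l<j  = noncrossing-SO k<l l<j (Same-trans (Same-sym i~k) i~j) (Opp-sym k~l)
    ... | inj₂ refl = Same-trans (Same-sym i~k) i~j

  Zero-under-block⇒Zero : Zero k → Same i j → i < k → k < j → Zero i
  Zero-under-block⇒Zero zk i~j i<k k<j = Zero-resp-Same (Same-sym i~k) zk
    where i~k = noncrossing-SO i<k k<j i~j zk

  Opp-encloses-Zero : Zero k → i < j → Opp i j → ¬ Zero i → i < k × k < j
  Opp-encloses-Zero {k} {i} {j} zk i<j i~j ¬zi = i<k , k<j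
    where
    i<k : i < k
    i<k with Finₚ.<-cmp k i
    ... | tri< k<i _ _  =
      ⊥-elim (¬zi (Zero-resp-Same (noncrossing-OO k<i (Finₚ.<-trans k<i i<j) zk i~j) zk))
    ... | tri≈ _ refl _ = ⊥-elim (¬zi zk)
    ... | tri> _ _ i<k  = i<k
    k<j : k < j
    k<j with Finₚ.<-cmp k j
    ... | tri< k<j _ _  = k<j
    ... | tri≈ _ refl _ = ⊥-elim (¬zi (Zero-Opp zk (Opp-sym i~j)))
    ... | tri> _ _ j<k  = ⊥-elim (¬zi (Zero-Opp zj (Opp-sym i~j)))
      where zj = Zero-resp-Same (Same-sym (noncrossing-OO j<k i<k (Opp-sym i~j) zk)) zk

  -- Without a zero block the links (c , −d) are nested; an empty gap marks the innermost one.
  Opp-encloses-Gap : NoZero → c < d → Opp c d → a < b → Opp a b → Gap a b → c ≤ a × b ≤ d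
  Opp-encloses-Gap {c} {d} {a} {b} noZero c<d c~d a<b a~b gap = ℕₚ.≮⇒≥ ¬a<c , ℕₚ.≮⇒≥ ¬d<b
    where
    ¬c~d : ¬ Same c d
    ¬c~d s = noZero d (Same-Opp (Same-sym s) c~d)
    ¬a<c : ¬ a < c
    ¬a<c a<c with Finₚ.<-cmp c b
    ... | tri< c<b _ _  = gap c d a<c c<b c~d
    ... | tri≈ _ refl _ = ¬c~d (noncrossing-OO c<d a<c (Opp-sym a~b) (Opp-sym c~d))
    ... | tri> _ _ b<c  = ¬c~d (Same-trans (Same-sym b~c) b~d)
      where
      b~c = noncrossing-OO b<c (Finₚ.<-trans a<c c<d) (Opp-sym a~b) c~d
      b~d = noncrossing-OO (Finₚ.<-trans b<c c<d) a<c (Opp-sym a~b) (Opp-sym c~d)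
    ¬d<b : ¬ d < b
    ¬d<b d<b with Finₚ.<-cmp a d
    ... | tri< a<d _ _  = gap d c a<d d<b (Opp-sym c~d)
    ... | tri≈ _ refl _ = ¬c~d (noncrossing-OO c<d a<b c~d a~b)
    ... | tri> _ _ d<a  = ¬c~d (Same-trans c~a (Same-sym d~a))
      where
      c~a = noncrossing-OO (Finₚ.<-trans c<d d<a) d<b c~d a~b
      d~a = noncrossing-OO d<a (Finₚ.<-trans c<d d<b) (Opp-sym c~d) a~b

  Gap⇒≤ : Gap c d → Opp k l → k < d → k ≤ c
  Gap⇒≤ gap k~l k<d = ℕₚ.≮⇒≥ λ c<k → gap _ _ c<k k<d k~l

  Gap⇒≥ : Gap c d → Opp k l → c < k → d ≤ k
  Gap⇒≥ gap k~l c<k = ℕₚ.≮⇒≥ λ k<d → gap _ _ c<k k<d k~l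

  Gap-nested-shorter : Gap c d → c < d → Opp i j → i < d → c < j →
    (i ≡ c × j ≡ d) ⊎ edgeLength c d ℕ.< edgeLength i j
  Gap-nested-shorter gap c<d i~j i<d c<j =
    nested-shorter (Gap⇒≤ gap i~j i<d) c<d (Gap⇒≥ gap (Opp-sym i~j) c<j)

  -- A block reaching across the innermost link (c , −d) would cover it, putting d in a zero block;
  -- so it lies strictly inside, and all its edges are shorter than (c , d).
  innermost-not-under-block : NoZero → c < d → Opp c d → Gap c d →
    Same i j → c < j → i < d → i ≤ k → l ≤ j →
    ¬ ((k ≡ c × l ≡ d) ⊎ edgeLength c d ℕ.< edgeLength k l)
  innermost-not-under-block {c} {d} {i} {j} {k} {l} noZero c<d c~d gap i~j c<j i<d i≤k l≤j
    with T? (η i c)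
  ... | yes i~c = λ _ → noZero d (Opp-under-block⇒Zero i~j (Gap⇒≤ gap (Same-Opp i~c c~d) i<d) c<d
                       (Gap⇒≥ gap (Same-Opp (Same-trans (Same-sym i~j) i~c) c~d) c<j) c~d)
  ... | no ¬i~c = inside
    where
    c<i : c < i
    c<i with Finₚ.<-cmp i c
    ... | tri< i<c _ _  = ⊥-elim (¬i~c (noncrossing-SO i<c c<j i~j c~d))
    ... | tri≈ _ refl _ = ⊥-elim (¬i~c (Same-refl i))
    ... | tri> _ _ c<i  = c<i
    j≤d : j ≤ d
    j≤d = ℕₚ.≮⇒≥ λ d<j →
      gap i c c<i i<d (Same-Opp (noncrossing-SO i<d d<j i~j (Opp-sym c~d)) (Opp-sym c~d))
    inside : ¬ ((k ≡ c × l ≡ d) ⊎ edgeLength c d ℕ.< edgeLength k l)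
    inside (inj₁ (refl , _)) = ℕₚ.<⇒≱ c<i i≤k
    inside (inj₂ longer)     = ℕₚ.<⇒≱ longer
      (ℕₚ.≤-trans (edgeLength-mono i≤k l≤j) (edgeLength-mono (ℕₚ.<⇒≤ c<i) j≤d))

  σ-edge-across : T (σ i j) → i ≤ a → a < j → b ≤ j →
    (∀ k → a < k → k < b → ¬ T (σ i k)) →
    ∃[ i′ ] ∃[ j′ ] IsEdge σ i′ j′ × T (σ i i′) × i ≤ i′ × i′ ≤ a × a < j′ × b ≤ j′ × j′ ≤ j
  σ-edge-across {i} {j} {a} {b} i~j i≤a a<j b≤j gap =
    i′ , j′ , (i′<j′ , σ-trans (σ-sym i~i′) i~j′ , no-between) ,
    i~i′ , Greatest.bound last-before i i-before , i′≤a , a<j′ , b≤j′ ,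
    Least.bound first-after j j-after
    where
    i-before : T (σ i i ∧ (i ≤ᶠ a))
    i-before = from T-∧ (σ-refl i , ℕₚ.≤⇒≤ᵇ i≤a)
    last-before = greatestOf (λ k → σ i k ∧ (k ≤ᶠ a)) i i-before
    i′ = Greatest.elem last-before
    i~i′ = proj₁ (to T-∧ (Greatest.holds last-before))
    i′≤a : i′ ≤ a
    i′≤a = ℕₚ.≤ᵇ⇒≤ (toℕ i′) _ (proj₂ (to T-∧ (Greatest.holds last-before)))
    j-after : T (σ i j ∧ (i′ <ᶠ j))
    j-after = from T-∧ (i~j , ℕₚ.<⇒<ᵇ (ℕₚ.≤-<-trans i′≤a a<j))
    first-after = leastOf (λ k → σ i k ∧ (i′ <ᶠ k)) j j-after
    j′ = Least.elem first-after
    i~j′ = proj₁ (to T-∧ (Least.holds first-after))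
    i′<j′ : i′ < j′
    i′<j′ = ℕₚ.<ᵇ⇒< (toℕ i′) _ (proj₂ (to T-∧ (Least.holds first-after)))
    a<j′ : a < j′
    a<j′ = ℕₚ.≰⇒> λ j′≤a →
      ℕₚ.<⇒≱ i′<j′ (Greatest.bound last-before j′ (from T-∧ (i~j′ , ℕₚ.≤⇒≤ᵇ j′≤a)))
    b≤j′ : b ≤ j′
    b≤j′ = ℕₚ.≮⇒≥ λ j′<b → gap j′ a<j′ j′<b i~j′
    no-between : ∀ k → i′ < k → k < j′ → ¬ T (σ i′ k)
    no-between k i′<k k<j′ i′~k =
      ℕₚ.<⇒≱ k<j′ (Least.bound first-after k (from T-∧ (σ-trans i~i′ i′~k , ℕₚ.<⇒<ᵇ i′<k)))

  Opp-Gap⇒IsEdge : a < b → Opp a b → Gap a b → IsEdge σ a b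
  Opp-Gap⇒IsEdge {a} {b} a<b a~b gap =
    a<b , Opp⇒σ a~b , λ k a<k k<b a~k → case σ⇒ a~k of λ where
      (inj₁ s) → gap k b a<k k<b (Same-Opp (Same-sym s) a~b)
      (inj₂ o) → gap k a a<k k<b (Opp-sym o)

  ZeroBlock⇒IsBlock : ∀ {B} → ZeroBlock B → Zero k → IsBlock σ B
  ZeroBlock⇒IsBlock {k} B≡ zk = k , λ l → trans (B≡ l) (T-ext (Same⇒σ ∘ Zero-Same zk) in-zero)
    where
    in-zero : T (σ k l) → Zero l
    in-zero x with σ⇒ x
    ... | inj₁ s = Zero-resp-Same s zk
    ... | inj₂ o = Zero-Opp zk o

  Zero? : ∀ i → Dec (Zero i)
  Zero? i = T? _

  ∈ZeroBlock⇒Zero : ∀ {B} → ZeroBlock B → T (B i) → Zero i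
  ∈ZeroBlock⇒Zero {i} B≡ = subst T (B≡ i)

  Zero⇒∈ZeroBlock : ∀ {B} → ZeroBlock B → Zero i → T (B i)
  Zero⇒∈ZeroBlock {i} B≡ = subst T (sym (B≡ i))

module Comparison {n : ℕ} (π₁ π₂ : NCB n) where

  module G₁ = Geometry π₁
  module G₂ = Geometry π₂
  open G₁ using () renaming
    (Same to Same₁; Opp to Opp₁; Zero to Zero₁; NoZero to NoZero₁; Gap to Gap₁; σ to σ₁; View to View₁)
  open G₂ using () renaming
    (Same to Same₂; Opp to Opp₂; Zero to Zero₂; NoZero to NoZero₂; Gap to Gap₂; σ to σ₂; View to View₂;
     ZeroBlock to ZeroBlock₂)

  private variable a b c d i j k z : Fin n

  Same-mono Opp-mono : Set
  Same-mono = ∀ {i j} → Same₁ i j → Same₂ i j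
  Opp-mono  = ∀ {i j} → Opp₁ i j → Opp₂ i j

  Covers : Fin n → Fin n → Fin n → Fin n → Set
  Covers a b i j = i ≤ a × b ≤ j

  Encloses : (Fin n → Bool) → Fin n → Fin n → Set
  Encloses B i j = ∀ k → T (B k) → i < k × k < j

  MinimalFor : (Fin n → Fin n → Set) → Fin n → Fin n → Set
  MinimalFor P c d = ∀ i j → IsEdge σ₁ i j → P i j → (i ≡ c × j ≡ d) ⊎ edgeLength c d ℕ.< edgeLength i j

  ≤NCB⇒ : π₁ ≤NCB π₂ → Same-mono × Opp-mono
  ≤NCB⇒ π₁≤π₂ = (λ {i} {j} → π₁≤π₂ (pos , i) (pos , j)) ,
                 (λ {i} {j} → π₁≤π₂ (pos , i) (neg , j))

  ⇒≤NCB : Same-mono → Opp-mono → π₁ ≤NCB π₂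
  ⇒≤NCB same opp (pos , i) (pos , j) x = same x
  ⇒≤NCB same opp (pos , i) (neg , j) x = opp x
  ⇒≤NCB same opp (neg , i) (pos , j) x =
    IsEquivalenceᵇ.symᵇ (isEquivB π₂) _ _ (opp (IsEquivalenceᵇ.symᵇ (isEquivB π₁) _ _ x))
  ⇒≤NCB same opp (neg , i) (neg , j) x =
    subst T (sym (symmB π₂ (pos , i) (pos , j))) (same (subst T (symmB π₁ (pos , i) (pos , j)) x))

  σ-mono : Same-mono → Opp-mono → σ₁ ≤ʳ σ₂
  σ-mono same opp i j x with G₁.σ⇒ x
  ... | inj₁ s = G₂.Same⇒σ (same s)
  ... | inj₂ o = G₂.Opp⇒σ (opp o)

  module Forward (same : Same-mono) (opp : Opp-mono) where

    covering-edge-is-Opp : NoZero₂ → a < b → Opp₂ a b → IsEdge σ₁ i j → Covers a b i j → Opp₁ i j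
    covering-edge-is-Opp noZero₂ a<b a~b (_ , i~j , _) (i≤a , b≤j) with G₁.σ⇒ i~j
    ... | inj₁ s = ⊥-elim (noZero₂ _ (G₂.Opp-under-block⇒Zero (same s) i≤a a<b b≤j a~b))
    ... | inj₂ o = o

    enclosing-edge-is-Opp : ∀ {B} → ZeroBlock₂ B → Zero₂ z → IsEdge σ₁ i j → Encloses B i j → Opp₁ i j
    enclosing-edge-is-Opp {z} B≡ zz (_ , i~j , _) enc with G₁.σ⇒ i~j
    ... | inj₂ o = o
    ... | inj₁ s = ⊥-elim (ℕₚ.<-irrefl refl (proj₁ (enc _ (G₂.Zero⇒∈ZeroBlock B≡ zi))))
      where
      z-inside = enc z (G₂.Zero⇒∈ZeroBlock B≡ zz)
      zi = G₂.Zero-under-block⇒Zero zz (same s) (proj₁ z-inside) (proj₂ z-inside)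

    covering-MinEdge : ∀ {x₁} → NoZero₂ → a < b → Opp₂ a b → Gap₂ a b → View₁ x₁ →
      MinEdgeOrEmpty σ₁ (Covers a b) x₁
    covering-MinEdge noZero₂ a<b a~b gap₂ (G₁.none no-Opp₁) =
      inj₂ ((λ i j e cov → no-Opp₁ i j (covering-edge-is-Opp noZero₂ a<b a~b e cov)) , refl)
    covering-MinEdge {a} {b} noZero₂ a<b a~b gap₂ (G₁.edge {c} {d} _ c<d c~d gap₁) =
      inj₁ (c , d , refl , G₁.Opp-Gap⇒IsEdge c<d c~d gap₁ , (c≤a , b≤d) , minimal)
      where
      c≤a,b≤d = G₂.Opp-encloses-Gap noZero₂ c<d (opp c~d) a<b a~b gap₂
      c≤a = proj₁ c≤a,b≤d
      b≤d = proj₂ c≤a,b≤d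
      minimal : MinimalFor (Covers a b) c d
      minimal i′ j′ e (i′≤a , b≤j′) =
        G₁.Gap-nested-shorter gap₁ c<d (covering-edge-is-Opp noZero₂ a<b a~b e (i′≤a , b≤j′))
          (ℕₚ.≤-<-trans i′≤a (ℕₚ.<-≤-trans a<b b≤d)) (ℕₚ.≤-<-trans c≤a (ℕₚ.<-≤-trans a<b b≤j′))
    covering-MinEdge noZero₂ _ _ _ (G₁.block z _ zz) = ⊥-elim (noZero₂ z (opp zz))

    block-Cases : ∀ {x₁ B} → ZeroBlock₂ B → Zero₂ z → View₁ x₁ → Cases σ₁ x₁ σ₂ (block B)
    block-Cases {B = B} B≡ zz (G₁.none no-Opp₁) =
      inj₂ (inj₂ (inj₂ (inj₂ (B , refl , G₂.ZeroBlock⇒IsBlock B≡ zz ,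
        inj₂ ((λ i j e enc → no-Opp₁ i j (enclosing-edge-is-Opp B≡ zz e enc)) , refl)))))
    block-Cases {z} {B = B} B≡ zz (G₁.edge {c} {d} _ c<d c~d gap₁) with G₂.Zero? c
    ... | yes zc = inj₂ (inj₂ (inj₂ (inj₁ (B , c , d , refl , G₂.ZeroBlock⇒IsBlock B≡ zz , refl ,
      G₁.Opp-Gap⇒IsEdge c<d c~d gap₁ ,
      G₂.Zero⇒∈ZeroBlock B≡ zc , G₂.Zero⇒∈ZeroBlock B≡ (G₂.Zero-Opp zc (opp c~d))))))
    ... | no ¬zc = inj₂ (inj₂ (inj₂ (inj₂ (B , refl , G₂.ZeroBlock⇒IsBlock B≡ zz ,
      inj₁ (c , d , refl , G₁.Opp-Gap⇒IsEdge c<d c~d gap₁ , enc , minimal)))))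
      where
      enc : Encloses B c d
      enc k k∈B = G₂.Opp-encloses-Zero (G₂.∈ZeroBlock⇒Zero B≡ k∈B) c<d (opp c~d) ¬zc
      minimal : MinimalFor (Encloses B) c d
      minimal i′ j′ e enc′ =
        let z∈B = G₂.Zero⇒∈ZeroBlock B≡ zz in
        G₁.Gap-nested-shorter gap₁ c<d (enclosing-edge-is-Opp B≡ zz e enc′)
          (Finₚ.<-trans (proj₁ (enc′ z z∈B)) (proj₂ (enc z z∈B)))
          (Finₚ.<-trans (proj₁ (enc z z∈B)) (proj₂ (enc′ z z∈B)))
    block-Cases {B = B} B≡ zz (G₁.block {B₁} _ B₁≡ zz₁) =
      inj₂ (inj₂ (inj₁ (B , B₁ , refl , G₂.ZeroBlock⇒IsBlock B≡ zz ,
        refl , G₁.ZeroBlock⇒IsBlock B₁≡ zz₁ ,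
        λ k k∈B₁ → G₂.Zero⇒∈ZeroBlock B≡ (opp (G₁.∈ZeroBlock⇒Zero B₁≡ k∈B₁)))))

    refinement⇒Cases : ∀ {x₁ x₂} → View₁ x₁ → View₂ x₂ → Cases σ₁ x₁ σ₂ x₂
    refinement⇒Cases (G₁.none _)         (G₂.none _)       = inj₁ (refl , refl)
    refinement⇒Cases (G₁.edge _ _ c~d _) (G₂.none no-Opp₂) = ⊥-elim (no-Opp₂ _ _ (opp c~d))
    refinement⇒Cases (G₁.block z _ zz)   (G₂.none no-Opp₂) = ⊥-elim (no-Opp₂ z z (opp zz))
    refinement⇒Cases v₁ (G₂.edge {a} {b} noZero₂ a<b a~b gap₂) =
      inj₂ (inj₁ (a , b , refl , G₂.Opp-Gap⇒IsEdge a<b a~b gap₂ , covering-MinEdge noZero₂ a<b a~b gap₂ v₁))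
    refinement⇒Cases v₁ (G₂.block _ B≡ zz) = block-Cases B≡ zz v₁

  module Backward (σ≤ : σ₁ ≤ʳ σ₂) where

    Same₁⇒σ₂ : Same₁ i j → Same₂ i j ⊎ Opp₂ i j
    Same₁⇒σ₂ s = G₂.σ⇒ (σ≤ _ _ (G₁.Same⇒σ s))

    Opp₁⇒σ₂ : Opp₁ i j → Same₂ i j ⊎ Opp₂ i j
    Opp₁⇒σ₂ o = G₂.σ⇒ (σ≤ _ _ (G₁.Opp⇒σ o))

    -- Given σ₁ ≤ σ₂, π₁ ≤ π₂ fails only if a Same₁-pair becomes an Opp₂-pair or an Opp₁-pair a
    -- Same₂-pair; inside zero blocks both are harmless, and it suffices to look at i < j.
    NoSplit ZeroMono JoinsInZero : Set
    NoSplit     = ∀ {i j} → i < j → Same₁ i j → Opp₂ i j → ¬ Zero₂ i → ⊥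
    ZeroMono    = ∀ {k} → Zero₁ k → Zero₂ k
    JoinsInZero = ∀ {i j} → i < j → Opp₁ i j → Same₂ i j → ¬ Zero₁ i → Zero₂ i

    Same-mono-from : NoSplit → Same-mono
    Same-mono-from no-split {i} {j} s with Same₁⇒σ₂ s
    ... | inj₁ s₂ = s₂
    ... | inj₂ o₂ with G₂.Zero? i
    ...   | yes zi = G₂.Opp-Opp⇒Sameʳ zi o₂
    ...   | no ¬zi with Finₚ.<-cmp i j
    ...     | tri< i<j _ _  = ⊥-elim (no-split i<j s o₂ ¬zi)
    ...     | tri≈ _ refl _ = G₂.Same-refl i
    ...     | tri> _ _ j<i  =
      ⊥-elim (no-split j<i (G₁.Same-sym s) (G₂.Opp-sym o₂)
                (¬zi ∘ λ zj → G₂.Zero-Opp zj (G₂.Opp-sym o₂)))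

    Opp-mono-from : ZeroMono → JoinsInZero → Opp-mono
    Opp-mono-from zero-mono joins-in-zero {i} {j} o with Opp₁⇒σ₂ o
    ... | inj₂ o₂ = o₂
    ... | inj₁ s₂ = G₂.Opp-Same zi s₂
      where
      zi : Zero₂ i
      zi with G₁.Zero? i
      ... | yes zi₁ = zero-mono zi₁
      ... | no ¬zi₁ with Finₚ.<-cmp i j
      ...   | tri< i<j _ _  = joins-in-zero i<j o s₂ ¬zi₁
      ...   | tri≈ _ refl _ = ⊥-elim (¬zi₁ o)
      ...   | tri> _ _ j<i  = G₂.Zero-resp-Same (G₂.Same-sym s₂)
        (joins-in-zero j<i (G₁.Opp-sym o) (G₂.Same-sym s₂)
                 (¬zi₁ ∘ λ zj → G₁.Zero-Opp zj (G₁.Opp-sym o)))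

    refines : NoSplit → ZeroMono → JoinsInZero → Same-mono × Opp-mono
    refines no-split zero-mono joins-in-zero =
      Same-mono-from no-split , Opp-mono-from zero-mono joins-in-zero

    refines-without-Opp₁ : (∀ i k → ¬ Opp₁ i k) → NoSplit → Same-mono × Opp-mono
    refines-without-Opp₁ no-Opp₁ no-split =
      refines no-split (λ {k} zk → ⊥-elim (no-Opp₁ k k zk))
                       (λ {i} {j} _ o → ⊥-elim (no-Opp₁ i j o))

    refines-without-Zero₁ : NoZero₁ → NoSplit → JoinsInZero → Same-mono × Opp-mono
    refines-without-Zero₁ noZero₁ no-split = refines no-split (λ {k} zk → ⊥-elim (noZero₁ k zk))

    σ₁-respects-Gap₂ : Opp₂ i j → Gap₂ a b → ∀ k → a < k → k < b → ¬ T (σ₁ i k)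
    σ₁-respects-Gap₂ {i} {j} o gap₂ k a<k k<b x with G₂.σ⇒ (σ≤ i k x)
    ... | inj₁ s  = gap₂ k j a<k k<b (G₂.Same-Opp (G₂.Same-sym s) o)
    ... | inj₂ o′ = gap₂ k i a<k k<b (G₂.Opp-sym o′)

    covering-edge : NoZero₂ → a < b → Opp₂ a b → Gap₂ a b → i < j → Same₁ i j → Opp₂ i j →
      ∃[ i′ ] ∃[ j′ ] IsEdge σ₁ i′ j′ × Covers a b i′ j′ × i ≤ i′ × j′ ≤ j
    covering-edge noZero₂ a<b a~b gap₂ i<j s o =
      let i≤a , b≤j = G₂.Opp-encloses-Gap noZero₂ i<j o a<b a~b gap₂
          i′ , j′ , e , _ , i≤i′ , i′≤a , _ , b≤j′ , j′≤j =
            G₁.σ-edge-across (G₁.Same⇒σ s) i≤a (ℕₚ.<-≤-trans a<b b≤j) b≤j (σ₁-respects-Gap₂ o gap₂)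
      in i′ , j′ , e , (i′≤a , b≤j′) , i≤i′ , j′≤j

    enclosing-edge : ∀ {B} → ZeroBlock₂ B → Zero₂ z → Same₁ i j → ¬ Zero₂ i → i < z → z < j →
      ∃[ i′ ] ∃[ j′ ] IsEdge σ₁ i′ j′ × Encloses B i′ j′ × i ≤ i′ × j′ ≤ j
    enclosing-edge {z} {i} {j} {B} B≡ zz s ¬zi i<z z<j
      with G₁.σ-edge-across {b = z} (G₁.Same⇒σ s) (ℕₚ.<⇒≤ i<z) z<j (ℕₚ.<⇒≤ z<j)
             (λ k z<k k<z → ⊥-elim (Finₚ.<-asym z<k k<z))
    ... | i′ , j′ , e , i~i′ , i≤i′ , i′≤z , z<j′ , _ , j′≤j =
      i′ , j′ , e , enc , i≤i′ , j′≤j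
      where
      ¬zi′ : ¬ Zero₂ i′
      ¬zi′ zi′ with G₂.σ⇒ (σ≤ i i′ i~i′)
      ... | inj₁ s₂ = ¬zi (G₂.Zero-resp-Same (G₂.Same-sym s₂) zi′)
      ... | inj₂ o₂ = ¬zi (G₂.Zero-Opp zi′ (G₂.Opp-sym o₂))
      i′<z : i′ < z
      i′<z = Finₚ.≤∧≢⇒< i′≤z λ { refl → ¬zi′ zz }
      i′~j′ : Opp₂ i′ j′
      i′~j′ with G₂.σ⇒ (σ≤ i′ j′ (proj₁ (proj₂ e)))
      ... | inj₁ s₂ = ⊥-elim (¬zi′ (G₂.Zero-under-block⇒Zero zz s₂ i′<z z<j′))
      ... | inj₂ o₂ = o₂
      enc : Encloses B i′ j′
      enc k k∈B = G₂.Opp-encloses-Zero (G₂.∈ZeroBlock⇒Zero B≡ k∈B) (proj₁ e) i′~j′ ¬zi′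

    none-none⇒refinement : View₁ none → View₂ none → Same-mono × Opp-mono
    none-none⇒refinement (G₁.none no-Opp₁) (G₂.none no-Opp₂) =
      refines-without-Opp₁ no-Opp₁ λ {i} {j} _ _ o₂ _ → no-Opp₂ i j o₂

    none-edge⇒refinement : View₁ none → View₂ (edge a b) →
      (∀ i j → IsEdge σ₁ i j → ¬ Covers a b i j) → Same-mono × Opp-mono
    none-edge⇒refinement (G₁.none no-Opp₁) (G₂.edge noZero₂ a<b a~b gap₂) no-covering-edge =
      refines-without-Opp₁ no-Opp₁ λ i<j s o₂ _ →
        let i′ , j′ , e , cov , _ = covering-edge noZero₂ a<b a~b gap₂ i<j s o₂ in
        no-covering-edge i′ j′ e cov

    edge-edge⇒refinement : View₁ (edge c d) → View₂ (edge a b) →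
      Covers a b c d → MinimalFor (Covers a b) c d → Same-mono × Opp-mono
    edge-edge⇒refinement {c} {d} {a} {b} (G₁.edge noZero₁ c<d c~d gap₁) (G₂.edge noZero₂ a<b a~b gap₂)
      (c≤a , b≤d) minimal = refines-without-Zero₁ noZero₁ no-split joins-in-zero
      where
      no-split : NoSplit
      no-split i<j s o₂ _ =
        let i′ , j′ , e , (i′≤a , b≤j′) , i≤i′ , j′≤j =
              covering-edge noZero₂ a<b a~b gap₂ i<j s o₂ in
        G₁.innermost-not-under-block noZero₁ c<d c~d gap₁ s
          (ℕₚ.≤-<-trans c≤a (ℕₚ.<-≤-trans a<b (ℕₚ.≤-trans b≤j′ j′≤j)))
          (ℕₚ.≤-<-trans (ℕₚ.≤-trans i≤i′ i′≤a) (ℕₚ.<-≤-trans a<b b≤d))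
          i≤i′ j′≤j (minimal i′ j′ e (i′≤a , b≤j′))
      joins-in-zero : JoinsInZero
      joins-in-zero i<j o s₂ _ =
        let i≤c , d≤j = G₁.Opp-encloses-Gap noZero₁ i<j o c<d c~d gap₁ in
        ⊥-elim (noZero₂ b
          (G₂.Opp-under-block⇒Zero s₂ (ℕₚ.≤-trans i≤c c≤a) a<b (ℕₚ.≤-trans b≤d d≤j) a~b))

    block-block⇒refinement : ∀ {B₁ B₂} → View₁ (block B₁) → View₂ (block B₂) → B₁ ⊆ᵇ B₂ →
      Same-mono × Opp-mono
    block-block⇒refinement (G₁.block z₁ B₁≡ zz₁) (G₂.block _ B₂≡ _) B₁⊆B₂ =
      refines no-split zero-mono joins-in-zero
      where
      zero-mono : ZeroMono
      zero-mono {k} zk = G₂.∈ZeroBlock⇒Zero B₂≡ (B₁⊆B₂ k (G₁.Zero⇒∈ZeroBlock B₁≡ zk))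
      no-split : NoSplit
      no-split i<j s o₂ ¬zi =
        let i<z₁ , z₁<j = G₂.Opp-encloses-Zero (zero-mono zz₁) i<j o₂ ¬zi in
        ¬zi (zero-mono (G₁.Zero-under-block⇒Zero zz₁ s i<z₁ z₁<j))
      joins-in-zero : JoinsInZero
      joins-in-zero i<j o s₂ ¬zi₁ =
        let i<z₁ , z₁<j = G₁.Opp-encloses-Zero zz₁ i<j o ¬zi₁ in
        G₂.Zero-under-block⇒Zero (zero-mono zz₁) s₂ i<z₁ z₁<j

    edge-block⇒refinement : ∀ {B₂} → View₁ (edge c d) → View₂ (block B₂) → T (B₂ c) → T (B₂ d) →
      Same-mono × Opp-mono
    edge-block⇒refinement {c} {d} (G₁.edge noZero₁ c<d c~d gap₁) (G₂.block _ B₂≡ _) c∈B₂ d∈B₂ =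
      refines-without-Zero₁ noZero₁ no-split joins-in-zero
      where
      zc = G₂.∈ZeroBlock⇒Zero B₂≡ c∈B₂
      zd = G₂.∈ZeroBlock⇒Zero B₂≡ d∈B₂
      no-split : NoSplit
      no-split i<j s o₂ ¬zi =
        let i<c , _ = G₂.Opp-encloses-Zero zc i<j o₂ ¬zi
            _ , d<j = G₂.Opp-encloses-Zero zd i<j o₂ ¬zi
        in noZero₁ d (G₁.Opp-under-block⇒Zero s (ℕₚ.<⇒≤ i<c) c<d (ℕₚ.<⇒≤ d<j) c~d)
      joins-in-zero : JoinsInZero
      joins-in-zero i<j o s₂ _ with G₁.Opp-encloses-Gap noZero₁ i<j o c<d c~d gap₁
      ... | i≤c , d≤j with ≤⇒<⊎≡ i≤c
      ...   | inj₁ i<c  = G₂.Zero-under-block⇒Zero zc s₂ i<c (ℕₚ.<-≤-trans c<d d≤j)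
      ...   | inj₂ refl = zc

    none-block⇒refinement : ∀ {B₂} → View₁ none → View₂ (block B₂) →
      (∀ i j → IsEdge σ₁ i j → ¬ Encloses B₂ i j) → Same-mono × Opp-mono
    none-block⇒refinement (G₁.none no-Opp₁) (G₂.block _ B₂≡ zz₂) no-enclosing-edge =
      refines-without-Opp₁ no-Opp₁ λ i<j s o₂ ¬zi →
        let i<z , z<j = G₂.Opp-encloses-Zero zz₂ i<j o₂ ¬zi
            i′ , j′ , e , enc , _ = enclosing-edge B₂≡ zz₂ s ¬zi i<z z<j
        in no-enclosing-edge i′ j′ e enc

    edge-enclosing-block⇒refinement : ∀ {B₂} → View₁ (edge c d) → View₂ (block B₂) →
      Encloses B₂ c d → MinimalFor (Encloses B₂) c d → Same-mono × Opp-mono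
    edge-enclosing-block⇒refinement {c} {d}
      (G₁.edge noZero₁ c<d c~d gap₁) (G₂.block z₂ B₂≡ zz₂) enc minimal =
      refines-without-Zero₁ noZero₁ no-split joins-in-zero
      where
      c<z₂<d = enc z₂ (G₂.Zero⇒∈ZeroBlock B₂≡ zz₂)
      no-split : NoSplit
      no-split i<j s o₂ ¬zi =
        let i<z , z<j = G₂.Opp-encloses-Zero zz₂ i<j o₂ ¬zi
            i′ , j′ , e , enc′ , i≤i′ , j′≤j = enclosing-edge B₂≡ zz₂ s ¬zi i<z z<j
        in G₁.innermost-not-under-block noZero₁ c<d c~d gap₁ s
             (Finₚ.<-trans (proj₁ c<z₂<d) z<j) (Finₚ.<-trans i<z (proj₂ c<z₂<d))
             i≤i′ j′≤j (minimal i′ j′ e enc′)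
      joins-in-zero : JoinsInZero
      joins-in-zero i<j o s₂ _ =
        let i≤c , d≤j = G₁.Opp-encloses-Gap noZero₁ i<j o c<d c~d gap₁ in
        G₂.Zero-under-block⇒Zero zz₂ s₂
          (ℕₚ.≤-<-trans i≤c (proj₁ c<z₂<d)) (ℕₚ.<-≤-trans (proj₂ c<z₂<d) d≤j)

    Cases⇒refinement : ∀ {x₁ x₂} → Cases σ₁ x₁ σ₂ x₂ → View₁ x₁ → View₂ x₂ → Same-mono × Opp-mono
    Cases⇒refinement (inj₁ (refl , refl))
      v₁ v₂ = none-none⇒refinement v₁ v₂
    Cases⇒refinement (inj₂ (inj₁ (_ , _ , refl , _ , inj₂ (no-covering-edge , refl))))
      v₁ v₂ = none-edge⇒refinement v₁ v₂ no-covering-edge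
    Cases⇒refinement (inj₂ (inj₁ (_ , _ , refl , _ , inj₁ (_ , _ , refl , _ , cov , minimal))))
      v₁ v₂ = edge-edge⇒refinement v₁ v₂ cov minimal
    Cases⇒refinement (inj₂ (inj₂ (inj₁ (_ , _ , refl , _ , refl , _ , B₁⊆B₂))))
      v₁ v₂ = block-block⇒refinement v₁ v₂ B₁⊆B₂
    Cases⇒refinement (inj₂ (inj₂ (inj₂ (inj₁ (_ , _ , _ , refl , _ , refl , _ , c∈B₂ , d∈B₂)))))
      v₁ v₂ = edge-block⇒refinement v₁ v₂ c∈B₂ d∈B₂
    Cases⇒refinement (inj₂ (inj₂ (inj₂ (inj₂ (_ , refl , _ , inj₂ (no-enclosing-edge , refl))))))
      v₁ v₂ = none-block⇒refinement v₁ v₂ no-enclosing-edge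
    Cases⇒refinement (inj₂ (inj₂ (inj₂ (inj₂ (_ , refl , _ , inj₁ (_ , _ , refl , _ , enc , minimal))))))
      v₁ v₂ = edge-enclosing-block⇒refinement v₁ v₂ enc minimal

proposition3p4 : (n : ℕ) (π₁ π₂ : NCB n) (x₁ x₂ : Decor n) →
    ψx π₁ x₁ → ψx π₂ x₂ →
    (π₁ ≤NCB π₂) ⇔ (ψσ π₁ ≤ʳ ψσ π₂ × Cases (ψσ π₁) x₁ (ψσ π₂) x₂)
proposition3p4 n π₁ π₂ x₁ x₂ ψ₁ ψ₂ = mk⇔
  (λ π₁≤π₂ → let same , opp = ≤NCB⇒ π₁≤π₂ in
    σ-mono same opp , Forward.refinement⇒Cases same opp v₁ v₂)
  (λ (σ≤ , cases) → let same , opp = Backward.Cases⇒refinement σ≤ cases v₁ v₂ in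
    ⇒≤NCB same opp)
  where
  open Comparison π₁ π₂
  v₁ = G₁.view ψ₁
  v₂ = G₂.view ψ₂
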